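{- Let $\mathcal B$ be a BALFI for $\mathbf{RCbr}$, let $\mathcal C=\{x\in\mathcal B: x\sqcap\tilde\neg x=0\}$ and $\mathcal I=\mathcal B\setminus\mathcal C$. Then for every $x\in\mathcal B$: (1) $x\in\mathcal C$ iff $x=\tilde\neg(-x)$; (2) $x\in\mathcal C$ iff $x=-\tilde\neg x$; (3) $x\in\mathcal C$ iff $-x\in\mathcal C$; (4) $x\in\mathcal C$ iff $\tilde\neg x\in\mathcal C$; (5) $x\in\mathcal I$ iff $-x\in\mathcal I$; (6) $x\in\mathcal I$ iff $\tilde\neg x\in\mathcal I$.
   Context: A BALFI for $\mathbf{RCbr}$ is a Boolean algebra $\mathcal B$ (with meet $\sqcap$, join $\sqcup$, complement $-$, least element $0$ and greatest element $1$) expanded with two unary operators $\tilde\neg$ and $\tilde\circ$ such that, for every $x\in\mathcal B$: $x\sqcup\tilde\neg x=1$, $x\sqcap\tilde\neg x\sqcap\tilde\circ x=0$, $\tilde\circ x=-(x\sqcap\tilde\neg x)$, and $\tilde\neg\tilde\neg x=x$. Elements of $\mathcal C$ are called consistent and elements of $\mathcal I$ inconsistent. -}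

module Defs where

open import Level using (Level; suc; _⊔_)
open import Algebra.Core using (Op₁)
open import Algebra.Lattice.Bundles using (BooleanAlgebra)
open import Relation.Nullary using () renaming (¬_ to Not)
open import Function.Bundles using (_⇔_)

-- A BALFI for RCbr: a Boolean algebra (meet _∧_, join _∨_, complement ¬_,
-- bottom ⊥, top ⊤; equality is the setoid equality _≈_) expanded with two
-- unary operators ~¬ (paraconsistent negation) and ~∘ (consistency operator).
record BALFI-RCbr (c ℓ : Level) : Set (suc (c ⊔ ℓ)) where
  field
    booleanAlgebra : BooleanAlgebra c ℓ
  open BooleanAlgebra booleanAlgebra public
  field
    ~¬ : Op₁ Carrier
    ~∘ : Op₁ Carrier
    ~¬-cong : ∀ {x y} → x ≈ y → ~¬ x ≈ ~¬ y
    ~∘-cong : ∀ {x y} → x ≈ y → ~∘ x ≈ ~∘ y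
    ax-or   : ∀ x → (x ∨ ~¬ x) ≈ ⊤
    ax-ci   : ∀ x → ((x ∧ ~¬ x) ∧ ~∘ x) ≈ ⊥
    ax-circ : ∀ x → ~∘ x ≈ ¬ (x ∧ ~¬ x)
    ax-cf   : ∀ x → ~¬ (~¬ x) ≈ x

  IsC : Carrier → Set ℓ
  IsC x = (x ∧ ~¬ x) ≈ ⊥

  IsI : Carrier → Set ℓ
  IsI x = Not (IsC x)

-- By uniqueness of complements, and because x ∨ ~¬ x ≈ ⊤ always holds, x is
-- consistent exactly when ~¬ x is the Boolean complement ¬ x.  Every item
-- then follows by moving one of the congruent involutions ~¬ and ¬ across ≈;
-- only the axioms x ∨ ~¬ x ≈ ⊤ and ~¬ ~¬ x ≈ x are used.
module Submission where

open import Defs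
open import Data.Product using (_×_; _,_)
open import Function.Bundles using (_⇔_; mk⇔)
open import Function.Properties.Equivalence using (⇔-setoid)
open import Function.Related.TypeIsomorphisms using (¬-cong-⇔)
open import Algebra.Core using (Op₁)
open import Algebra.Lattice.Bundles using (BooleanAlgebra)
open import Relation.Binary.Bundles using (Setoid)
import Algebra.Definitions as AlgebraDefinitions
import Algebra.Lattice.Properties.BooleanAlgebra as BooleanAlgebraProperties
import Relation.Binary.Reasoning.Setoid as SetoidReasoning

module SetoidEquivalences {a ℓ} (S : Setoid a ℓ) where
  open Setoid S
  open AlgebraDefinitions _≈_ using (Congruent₁; Involutive)

  ≈-sym-⇔ : ∀ {x y} → (x ≈ y) ⇔ (y ≈ x)
  ≈-sym-⇔ = mk⇔ sym sym

  ≈-respˡ-⇔ : ∀ {x y z} → x ≈ y → (x ≈ z) ⇔ (y ≈ z)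
  ≈-respˡ-⇔ x≈y = mk⇔ (trans (sym x≈y)) (trans x≈y)

  involution-swap-⇔ : ∀ {f : Op₁ Carrier} → Congruent₁ f → Involutive f →
                      ∀ {x y} → (f x ≈ y) ⇔ (x ≈ f y)
  involution-swap-⇔ f-cong f-involutive {x} {y} = mk⇔
    (λ fx≈y → trans (sym (f-involutive x)) (f-cong fx≈y))
    (λ x≈fy → trans (f-cong x≈fy) (f-involutive y))

module ComplementUniqueness {c ℓ} (B : BooleanAlgebra c ℓ) where
  open BooleanAlgebra B
  open BooleanAlgebraProperties B using (∧-identityʳ; ∨-identityˡ)
  open SetoidReasoning setoid

  x∧y≈⊥⇒y∨z≈⊤⇒x≈x∧z : ∀ {x y z} → x ∧ y ≈ ⊥ → y ∨ z ≈ ⊤ → x ≈ x ∧ z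
  x∧y≈⊥⇒y∨z≈⊤⇒x≈x∧z {x} {y} {z} x∧y≈⊥ y∨z≈⊤ = begin
    x                  ≈⟨ ∧-identityʳ x ⟨
    x ∧ ⊤              ≈⟨ ∧-congˡ y∨z≈⊤ ⟨
    x ∧ (y ∨ z)        ≈⟨ ∧-distribˡ-∨ x y z ⟩
    (x ∧ y) ∨ (x ∧ z)  ≈⟨ ∨-congʳ x∧y≈⊥ ⟩
    ⊥ ∨ (x ∧ z)        ≈⟨ ∨-identityˡ (x ∧ z) ⟩
    x ∧ z              ∎

  ¬-unique : ∀ {x y} → x ∧ y ≈ ⊥ → x ∨ y ≈ ⊤ → ¬ x ≈ y
  ¬-unique {x} {y} x∧y≈⊥ x∨y≈⊤ = begin
    ¬ x      ≈⟨ x∧y≈⊥⇒y∨z≈⊤⇒x≈x∧z (∧-complementˡ x) x∨y≈⊤ ⟩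
    ¬ x ∧ y  ≈⟨ ∧-comm (¬ x) y ⟩
    y ∧ ¬ x  ≈⟨ x∧y≈⊥⇒y∨z≈⊤⇒x≈x∧z (trans (∧-comm y x) x∧y≈⊥) (∨-complementʳ x) ⟨
    y        ∎

module Consistency {c ℓ} (B : BALFI-RCbr c ℓ) where
  open BALFI-RCbr B
  open BooleanAlgebraProperties booleanAlgebra using (¬-involutive)
  open ComplementUniqueness booleanAlgebra using (¬-unique)
  open SetoidEquivalences setoid
  open SetoidReasoning (⇔-setoid ℓ)

  IsCx⇔~¬x≈¬x : ∀ x → IsC x ⇔ (~¬ x ≈ ¬ x)
  IsCx⇔~¬x≈¬x x = mk⇔
    (λ x∧~¬x≈⊥ → sym (¬-unique x∧~¬x≈⊥ (ax-or x)))
    (λ ~¬x≈¬x → trans (∧-congˡ ~¬x≈¬x) (∧-complementʳ x))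

  IsCx⇔x≈~¬¬x : ∀ x → IsC x ⇔ (x ≈ ~¬ (¬ x))
  IsCx⇔x≈~¬¬x x = begin
    IsC x            ≈⟨ IsCx⇔~¬x≈¬x x ⟩
    (~¬ x ≈ ¬ x)     ≈⟨ involution-swap-⇔ ~¬-cong ax-cf ⟩
    (x ≈ ~¬ (¬ x))   ∎

  IsCx⇔x≈¬~¬x : ∀ x → IsC x ⇔ (x ≈ ¬ (~¬ x))
  IsCx⇔x≈¬~¬x x = begin
    IsC x            ≈⟨ IsCx⇔~¬x≈¬x x ⟩
    (~¬ x ≈ ¬ x)     ≈⟨ ≈-sym-⇔ ⟩
    (¬ x ≈ ~¬ x)     ≈⟨ involution-swap-⇔ ¬-cong ¬-involutive ⟩
    (x ≈ ¬ (~¬ x))   ∎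

  IsCx⇔IsC¬x : ∀ x → IsC x ⇔ IsC (¬ x)
  IsCx⇔IsC¬x x = begin
    IsC x                ≈⟨ IsCx⇔x≈~¬¬x x ⟩
    (x ≈ ~¬ (¬ x))       ≈⟨ ≈-respˡ-⇔ (¬-involutive x) ⟨
    (¬ (¬ x) ≈ ~¬ (¬ x)) ≈⟨ ≈-sym-⇔ ⟩
    (~¬ (¬ x) ≈ ¬ (¬ x)) ≈⟨ IsCx⇔~¬x≈¬x (¬ x) ⟨
    IsC (¬ x)            ∎

  IsCx⇔IsC~¬x : ∀ x → IsC x ⇔ IsC (~¬ x)
  IsCx⇔IsC~¬x x = begin
    IsC x                  ≈⟨ IsCx⇔x≈¬~¬x x ⟩
    (x ≈ ¬ (~¬ x))         ≈⟨ ≈-respˡ-⇔ (ax-cf x) ⟨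
    (~¬ (~¬ x) ≈ ¬ (~¬ x)) ≈⟨ IsCx⇔~¬x≈¬x (~¬ x) ⟨
    IsC (~¬ x)             ∎

lemma4p2 : ∀ {c ℓ} (B : BALFI-RCbr c ℓ) → let open BALFI-RCbr B in
    ∀ x →
      (IsC x ⇔ (x ≈ ~¬ (¬ x))) ×
      (IsC x ⇔ (x ≈ ¬ (~¬ x))) ×
      (IsC x ⇔ IsC (¬ x)) ×
      (IsC x ⇔ IsC (~¬ x)) ×
      (IsI x ⇔ IsI (¬ x)) ×
      (IsI x ⇔ IsI (~¬ x))
lemma4p2 B x =
  IsCx⇔x≈~¬¬x x , IsCx⇔x≈¬~¬x x , IsCx⇔IsC¬x x , IsCx⇔IsC~¬x x ,
  ¬-cong-⇔ (IsCx⇔IsC¬x x) , ¬-cong-⇔ (IsCx⇔IsC~¬x x)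
  where open Consistency B
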